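{- For every integer $g \geq 5$, \[ f(2,2,g) \leq \left\lceil \frac{g}{2} \right\rceil \left\lfloor \frac{3g}{2} \right\rfloor = \begin{cases} \frac{3g^2}{4}, & g \text{ even},\\[4pt] \frac{3g^2+2g-1}{4}, & g \text{ odd}. \end{cases} \]
   Context: A mixed graph $G$ is a finite graph having both undirected edges (called edges) and directed edges (called arcs). The degree of a vertex is the number of edges incident with it; its out-degree is the number of arcs directed from it. A cycle in a mixed graph is a sequence of vertices $v_0, v_1, \dots, v_k$ with $v_0 = v_k$ such that each consecutive pair $v_i, v_{i+1}$ is joined either by an edge or by an arc directed from $v_i$ to $v_{i+1}$, and no edge or arc is used more than once; its length is $k$. The girth is the length of a shortest cycle. An $(r,z,g)$-graph is a mixed graph in which every vertex has degree $r$ and out-degree $z$, and which has girth $g$. $f(r,z,g)$ denotes the minimum order of an $(r,z,g)$-graph. -}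

module Defs where

open import Data.Nat using (ℕ; zero; suc; _+_; _*_; _≤_; _<_)
open import Data.Fin using (Fin; toℕ; fromℕ; inject₁) renaming (suc to fsuc; zero to fzero)
open import Data.Fin.Properties using (_≟_)
open import Data.List using (List; length; filter)
open import Data.List using () renaming (allFin to allFinL)
open import Data.Product using (Σ; _×_; _,_; proj₁; proj₂; ∃-syntax)
open import Data.Sum using (_⊎_; inj₁; inj₂)
open import Relation.Binary.PropositionalEquality using (_≡_)
open import Relation.Nullary using (¬_)
open import Function.Definitions using (Injective)

-- A finite mixed graph on vertex set Fin n.  Edges and arcs are indexed
-- families (so parallel edges/arcs and loops are representable; they are
-- excluded anyway once the girth is at least 3).
record MixedGraph (n : ℕ) : Set where
  field
    nE   : ℕ
    edge : Fin nE → Fin n × Fin n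
    nA   : ℕ
    arc  : Fin nA → Fin n × Fin n
open MixedGraph public

-- degree: number of edges incident with v (a loop would count twice)
degree : ∀ {n} → MixedGraph n → Fin n → ℕ
degree G v =
  length (filter (λ e → proj₁ (edge G e) ≟ v) (allFinL (nE G))) +
  length (filter (λ e → proj₂ (edge G e) ≟ v) (allFinL (nE G)))

outDegree : ∀ {n} → MixedGraph n → Fin n → ℕ
outDegree G v = length (filter (λ a → proj₁ (arc G a) ≟ v) (allFinL (nA G)))

Step : ∀ {n} → (G : MixedGraph n) → Fin (nE G) ⊎ Fin (nA G) → Fin n → Fin n → Set
Step G (inj₁ e) u w = edge G e ≡ (u , w) ⊎ edge G e ≡ (w , u)
Step G (inj₂ a) u w = arc G a ≡ (u , w)

record Cycle {n} (G : MixedGraph n) (k : ℕ) : Set where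
  field
    pos     : 1 ≤ k
    vtx     : Fin (suc k) → Fin n
    closed  : vtx fzero ≡ vtx (fromℕ k)
    use     : Fin k → Fin (nE G) ⊎ Fin (nA G)
    steps   : ∀ (i : Fin k) → Step G (use i) (vtx (inject₁ i)) (vtx (fsuc i))
    useInj  : Injective _≡_ _≡_ use

HasGirth : ∀ {n} → MixedGraph n → ℕ → Set
HasGirth G g = Cycle G g × (∀ k → k < g → ¬ Cycle G k)

IsRZGGraph : ∀ {n} → MixedGraph n → ℕ → ℕ → ℕ → Set
IsRZGGraph G r z g =
  (∀ v → degree G v ≡ r) × (∀ v → outDegree G v ≡ z) × HasGirth G g

-- "f(r,z,g) ≤ N": since f(r,z,g) is the minimum order of an (r,z,g)-graph,
-- this holds iff some (r,z,g)-graph has order at most N.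
fBoundedBy : ℕ → ℕ → ℕ → ℕ → Set
fBoundedBy r z g N = ∃[ n ] (n ≤ N × Σ (MixedGraph n) (λ G → IsRZGGraph G r z g))

module Submission where

-- The graph has vertex set ℤ_P × ℤ_Q with P = ⌈g/2⌉, m = ⌊g/2⌋ and Q = P + 2m = ⌊3g/2⌋.
-- Every row is an undirected Q-cycle, and (r , c) has arcs to (r + 1 , c) and (r + 1 , c + 1),
-- except that arcs leaving the last row also shift the column by m.  Following P arcs from
-- (0 , 0) and then m edges back along row 0 closes a cycle of length P + m = g.
-- Conversely, lift a closed walk with A arcs (B of the second kind), F forward and M backward
-- edge steps, wrapping around the rows W times: the rows give W P = A and the columns give
-- M ≡ F + B + W m (mod Q).  If the walk is shorter than P + m, then W ≥ 2 is too long and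
-- W = 1 displaces the column by strictly between 0 and Q, so A = 0 and M = F.  A walk
-- along one row that uses both directions reverses at some step, reusing an edge.

open import Data.Empty using (⊥-elim)
open import Data.Fin using (Fin; toℕ; fromℕ; inject₁; punchIn; _↑ˡ_; _↑ʳ_; combine; remQuot; splitAt)
  renaming (zero to fzero; suc to fsuc)
open import Data.Fin.Properties
  using (_≟_; toℕ-injective; toℕ-fromℕ; toℕ-fromℕ<; toℕ-inject₁; toℕ<n; punchInᵢ≢i; ↑ˡ-injective;
         remQuot-combine; combine-remQuot; splitAt-↑ˡ; splitAt-↑ʳ)
open import Data.List using (length; filter; tabulate)
open import Data.Nat
  using (ℕ; zero; suc; pred; _+_; _*_; _∸_; _/_; _%_; _≤_; _<_; z≤n; s≤s; _<?_; ⌈_/2⌉; ⌊_/2⌋;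
         NonZero; >-nonZero)
open import Data.Nat.DivMod
  using (_mod_; _divMod_; DivMod; m<n⇒m%n≡m; m<n⇒m/n≡0; n%n≡0; n/n≡1; [m+n]%n≡m%n; [m+kn]%n≡m%n;
         %-distribˡ-+; m%n%n≡m%n)
open import Data.Nat.Properties
  using (+-*-semiring; +-commutativeSemigroup; +-assoc; +-comm; +-suc; +-identityʳ; *-identityˡ;
         *-identityʳ; *-zeroʳ; +-cancelʳ-≡; +-cancelˡ-<; +-mono-≤; +-monoʳ-≤; +-monoˡ-≤; +-monoˡ-<;
         +-∸-assoc; m+[n∸m]≡n; m+n∸m≡n; m+n∸n≡m; m+n≡0⇒m≡0; m+n≡0⇒n≡0; m<n⇒0<n∸m; n∸n≡0;
         ∸-cancelˡ-≡; ∸-monoʳ-≤; 1+n≢0; 1+n≢n; suc-injective; suc-pred; m≤m+n; m≤n+m; m≤n⇒m≤1+n;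
         n<1+n; <-trans; <-≤-trans; ≤-<-trans; ≤-trans; ≤-refl; ≤-reflexive; ≤-antisym; <⇒≢; <⇒≤;
         <⇒≱; ≮⇒≥; ⌈n/2⌉-mono; ⌊n/2⌋≤⌈n/2⌉; ⌊n/2⌋+⌈n/2⌉≡n; module ≤-Reasoning)
open import Data.Nat.Tactic.RingSolver using (solve-∀)
open import Data.Product using (_×_; _,_; proj₁; proj₂; ∃; ∃₂; uncurry)
open import Data.Sum using (_⊎_; inj₁; inj₂)
open import Data.Sum.Properties using (inj₁-injective; inj₂-injective)
open import Data.Vec.Functional using (removeAt)
open import Function using (_∘_; id)
open import Relation.Binary.PropositionalEquality
open import Relation.Nullary using (Dec; yes; no; ¬_; contradiction)
open import Relation.Unary using (Pred; Decidable)

open import Defs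

open import Algebra.Properties.Semiring.Sum +-*-semiring
  using (sum; sum-cong-≗; ∑-distrib-+; *-distribʳ-sum; sum-remove)
open import Algebra.Properties.CommutativeSemigroup +-commutativeSemigroup using (x∙yz≈y∙xz)

-- Congruences and remainders

infix 4 _≡_modulo_
_≡_modulo_ : ℕ → ℕ → ℕ → Set
a ≡ b modulo n = ∃₂ λ x y → x * n + a ≡ y * n + b

≡-modulo-sym : ∀ {a b n} → a ≡ b modulo n → b ≡ a modulo n
≡-modulo-sym (x , y , eq) = y , x , sym eq

m/n*n+toℕ[m-mod-n]≡m : ∀ a n .{{_ : NonZero n}} → a / n * n + toℕ (a mod n) ≡ a
m/n*n+toℕ[m-mod-n]≡m a n = trans (+-comm (a / n * n) _) (sym (DivMod.property (a divMod n)))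

toℕ[m-mod-n]≡m-modulo-n : ∀ a n .{{_ : NonZero n}} → toℕ (a mod n) ≡ a modulo n
toℕ[m-mod-n]≡m-modulo-n a n = a / n , 0 , m/n*n+toℕ[m-mod-n]≡m a n

≡-modulo⇒≡ : ∀ {a b n} → a < n → b < n → a ≡ b modulo n → a ≡ b
≡-modulo⇒≡ {a} {b} {n} a<n b<n (x , y , eq) = begin
  a                 ≡⟨ m<n⇒m%n≡m a<n ⟨
  a % n             ≡⟨ [m+kn]%n≡m%n a x n ⟨
  (a + x * n) % n   ≡⟨ cong (_% n) (trans (+-comm a _) (trans eq (+-comm _ b))) ⟩
  (b + y * n) % n   ≡⟨ [m+kn]%n≡m%n b y n ⟩
  b % n             ≡⟨ m<n⇒m%n≡m b<n ⟩
  b                 ∎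
  where
  open ≡-Reasoning
  instance _ = >-nonZero (≤-<-trans z≤n a<n)

≢-modulo-between : ∀ {a b n} → a < b → b < a + n → ¬ a ≡ b modulo n
≢-modulo-between {a} {b} {n} a<b b<a+n (x , y , eq) =
  <⇒≢ (m<n⇒0<n∸m a<b) (≡-modulo⇒≡ (≤-<-trans z≤n d<n) d<n (x , y , cancelled))
  where
  d : ℕ
  d = b ∸ a
  a+d≡b : a + d ≡ b
  a+d≡b = m+[n∸m]≡n (<⇒≤ a<b)
  d<n : d < n
  d<n = +-cancelˡ-< a d n (subst (_< a + n) (sym a+d≡b) b<a+n)
  cancelled : x * n + 0 ≡ y * n + d
  cancelled = +-cancelʳ-≡ a _ _ (begin
    x * n + 0 + a    ≡⟨ cong (_+ a) (+-identityʳ (x * n)) ⟩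
    x * n + a        ≡⟨ eq ⟩
    y * n + b        ≡⟨ cong (y * n +_) a+d≡b ⟨
    y * n + (a + d)  ≡⟨ cong (y * n +_) (+-comm a d) ⟩
    y * n + (d + a)  ≡⟨ +-assoc (y * n) d a ⟨
    y * n + d + a    ∎)
    where open ≡-Reasoning

toℕ-mod-< : ∀ {a n} .{{_ : NonZero n}} → a < n → toℕ (a mod n) ≡ a
toℕ-mod-< a<n = trans (toℕ-fromℕ< _) (m<n⇒m%n≡m a<n)

mod-injective-< : ∀ {a b n} .{{_ : NonZero n}} → a < n → b < n → a mod n ≡ b mod n → a ≡ b
mod-injective-< a<n b<n eq = trans (sym (toℕ-mod-< a<n)) (trans (cong toℕ eq) (toℕ-mod-< b<n))

[m+toℕ[o-mod-n]]-mod-n≡[m+o]-mod-n : ∀ a b n .{{_ : NonZero n}} → (a + toℕ (b mod n)) mod n ≡ (a + b) mod n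
[m+toℕ[o-mod-n]]-mod-n≡[m+o]-mod-n a b n = toℕ-injective (begin
  toℕ ((a + toℕ (b mod n)) mod n)  ≡⟨ toℕ-fromℕ< _ ⟩
  (a + toℕ (b mod n)) % n          ≡⟨ cong (λ t → (a + t) % n) (toℕ-fromℕ< _) ⟩
  (a + b % n) % n                  ≡⟨ %-distribˡ-+ a (b % n) n ⟩
  (a % n + b % n % n) % n          ≡⟨ cong (λ t → (a % n + t) % n) (m%n%n≡m%n b n) ⟩
  (a % n + b % n) % n              ≡⟨ %-distribˡ-+ a b n ⟨
  (a + b) % n                      ≡⟨ toℕ-fromℕ< _ ⟨
  toℕ ((a + b) mod n)              ∎)
  where open ≡-Reasoning

[n+toℕ[i]]-mod-n≡i : ∀ {n} .{{_ : NonZero n}} (i : Fin n) → (n + toℕ i) mod n ≡ i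
[n+toℕ[i]]-mod-n≡i {n} i = toℕ-injective (begin
  toℕ ((n + toℕ i) mod n)  ≡⟨ toℕ-fromℕ< _ ⟩
  (n + toℕ i) % n          ≡⟨ cong (_% n) (+-comm n (toℕ i)) ⟩
  (toℕ i + n) % n          ≡⟨ [m+n]%n≡m%n (toℕ i) n ⟩
  toℕ i % n                ≡⟨ m<n⇒m%n≡m (toℕ<n i) ⟩
  toℕ i                    ∎)
  where open ≡-Reasoning

short-closed-walk-balance : ∀ {P m W A B F M} → m ≤ P → W * P ≡ A → B ≤ A → A + F + M < P + m →
                            M ≡ F + B + W * m modulo (P + m + m) → A ≡ 0 × M ≡ F
short-closed-walk-balance {P} {m} {zero} {F = F} {M} _ refl z≤n short M≡rhs =
  refl , ≡-modulo⇒≡ (below (m≤n+m M F)) (below (m≤m+n F M))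
                    (subst (λ t → M ≡ t modulo (P + m + m)) (trans (+-identityʳ _) (+-identityʳ F)) M≡rhs)
  where
  below : ∀ {x} → x ≤ F + M → x < P + m + m
  below x≤ = <-≤-trans (≤-<-trans x≤ short) (m≤m+n (P + m) m)
short-closed-walk-balance {P} {m} {suc zero} {B = B} {F} {M} _ refl B≤P short M≡rhs =
  contradiction (subst (λ t → M ≡ t modulo (P + m + m)) (cong (F + B +_) (+-identityʳ m)) M≡rhs)
                (≢-modulo-between (<-≤-trans M<m (m≤n+m m (F + B))) rhs<M+Q)
  where
  F+M<m : F + M < m
  F+M<m = +-cancelˡ-< P (F + M) m
            (subst (_< P + m) (trans (+-assoc (P + 0) F M) (cong (_+ (F + M)) (+-identityʳ P))) short)
  M<m : M < m
  M<m = ≤-<-trans (m≤n+m M F) F+M<m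
  rhs<M+Q : F + B + m < M + (P + m + m)
  rhs<M+Q = begin-strict
    F + B + m        ≤⟨ +-monoˡ-≤ m (+-monoʳ-≤ F (subst (B ≤_) (+-identityʳ P) B≤P)) ⟩
    F + P + m        <⟨ +-monoˡ-< m (+-monoˡ-< P (≤-<-trans (m≤m+n F M) F+M<m)) ⟩
    m + P + m        ≡⟨ cong (_+ m) (+-comm m P) ⟩
    P + m + m        ≤⟨ m≤n+m (P + m + m) M ⟩
    M + (P + m + m)  ∎
    where open ≤-Reasoning
short-closed-walk-balance {P} {m} {suc (suc W)} {F = F} {M} m≤P refl _ short _ = ⊥-elim (<⇒≱ short (begin
  P + m                    ≤⟨ +-monoʳ-≤ P (≤-trans m≤P (m≤m+n P (W * P))) ⟩
  P + (P + W * P)          ≤⟨ m≤m+n _ F ⟩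
  P + (P + W * P) + F      ≤⟨ m≤m+n _ M ⟩
  P + (P + W * P) + F + M  ∎))
  where open ≤-Reasoning

-- Finite sums and counting

sum-const : ∀ k c → sum {k} (λ _ → c) ≡ k * c
sum-const zero    c = refl
sum-const (suc k) c = cong (c +_) (sum-const k c)

sum-mono-≤ : ∀ {k} {f g : Fin k → ℕ} → (∀ i → f i ≤ g i) → sum f ≤ sum g
sum-mono-≤ {zero}  f≤g = z≤n
sum-mono-≤ {suc k} f≤g = +-mono-≤ (f≤g fzero) (sum-mono-≤ (f≤g ∘ fsuc))

sum≡0⇒≡0 : ∀ {k} (f : Fin k → ℕ) → sum f ≡ 0 → ∀ i → f i ≡ 0
sum≡0⇒≡0 f Σf≡0 fzero    = m+n≡0⇒m≡0 (f fzero) Σf≡0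
sum≡0⇒≡0 f Σf≡0 (fsuc i) = sum≡0⇒≡0 (f ∘ fsuc) (m+n≡0⇒n≡0 (f fzero) Σf≡0) i

sum-↑ : ∀ m {n} (f : Fin (m + n) → ℕ) → sum f ≡ sum (f ∘ (_↑ˡ n)) + sum (f ∘ (m ↑ʳ_))
sum-↑ zero    f = refl
sum-↑ (suc m) f = trans (cong (f fzero +_) (sum-↑ m (f ∘ fsuc))) (sym (+-assoc (f fzero) _ _))

telescope : ∀ {k} (x : Fin (suc k) → ℕ) (d u : Fin k → ℕ) →
            (∀ i → d i + x (fsuc i) ≡ u i + x (inject₁ i)) →
            sum d + x (fromℕ k) ≡ sum u + x fzero
telescope {zero}  x d u step = refl
telescope {suc k} x d u step = begin
  d₀ + sum (d ∘ fsuc) + x (fromℕ (suc k))    ≡⟨ +-assoc d₀ _ _ ⟩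
  d₀ + (sum (d ∘ fsuc) + x (fromℕ (suc k)))  ≡⟨ cong (d₀ +_) (telescope (x ∘ fsuc) _ _ (step ∘ fsuc)) ⟩
  d₀ + (sum (u ∘ fsuc) + x₁)                 ≡⟨ x∙yz≈y∙xz d₀ _ x₁ ⟩
  sum (u ∘ fsuc) + (d₀ + x₁)                 ≡⟨ cong (sum (u ∘ fsuc) +_) (step fzero) ⟩
  sum (u ∘ fsuc) + (u₀ + x₀)                 ≡⟨ x∙yz≈y∙xz (sum (u ∘ fsuc)) u₀ x₀ ⟩
  u₀ + (sum (u ∘ fsuc) + x₀)                 ≡⟨ +-assoc u₀ _ _ ⟨
  u₀ + sum (u ∘ fsuc) + x₀                   ∎
  where
  open ≡-Reasoning
  d₀ u₀ x₀ x₁ : ℕ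
  d₀ = d fzero
  u₀ = u fzero
  x₀ = x fzero
  x₁ = x (fsuc fzero)

closed-telescope : ∀ {k} (x : Fin (suc k) → ℕ) (d u : Fin k → ℕ) → x (fromℕ k) ≡ x fzero →
                   (∀ i → d i + x (fsuc i) ≡ u i + x (inject₁ i)) → sum d ≡ sum u
closed-telescope x d u closed step =
  +-cancelʳ-≡ (x fzero) _ _ (trans (cong (sum d +_) (sym closed)) (telescope x d u step))

closed-telescope-modulo : ∀ {k n} (x : Fin (suc k) → ℕ) (d u : Fin k → ℕ) → x (fromℕ k) ≡ x fzero →
                          (∀ i → d i + x (fsuc i) ≡ u i + x (inject₁ i) modulo n) →
                          sum d ≡ sum u modulo n
closed-telescope-modulo {k} {n} x d u closed step =
  sum X , sum Y , (begin
    sum X * n + sum d          ≡⟨ sum-linear X d ⟨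
    sum (λ i → X i * n + d i)  ≡⟨ closed-telescope x _ _ closed exact-step ⟩
    sum (λ i → Y i * n + u i)  ≡⟨ sum-linear Y u ⟩
    sum Y * n + sum u          ∎)
  where
  open ≡-Reasoning
  X Y : Fin k → ℕ
  X i = proj₁ (step i)
  Y i = proj₁ (proj₂ (step i))
  exact-step : ∀ i → X i * n + d i + x (fsuc i) ≡ Y i * n + u i + x (inject₁ i)
  exact-step i = trans (+-assoc (X i * n) _ _) (trans (proj₂ (proj₂ (step i))) (sym (+-assoc (Y i * n) _ _)))
  sum-linear : ∀ (f g : Fin k → ℕ) → sum (λ i → f i * n + g i) ≡ sum f * n + sum g
  sum-linear f g = trans (∑-distrib-+ (λ i → f i * n) g) (cong (_+ sum g) (sym (*-distribʳ-sum n f)))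

indicator : ∀ {p} {P : Set p} → Dec P → ℕ
indicator (yes _) = 1
indicator (no _)  = 0

length-filter-tabulate : ∀ {a p} {A : Set a} {P : Pred A p} (P? : Decidable P) {N} (f : Fin N → A) →
                         length (filter P? (tabulate f)) ≡ sum (indicator ∘ P? ∘ f)
length-filter-tabulate P? {zero}  f = refl
length-filter-tabulate P? {suc N} f with P? (f fzero)
... | yes _ = cong suc (length-filter-tabulate P? (f ∘ fsuc))
... | no  _ = length-filter-tabulate P? (f ∘ fsuc)

sum-indicator-unique : ∀ {N p} {P : Pred (Fin N) p} (P? : Decidable P) {u} →
                       P u → (∀ e → P e → e ≡ u) → sum (indicator ∘ P?) ≡ 1
sum-indicator-unique {suc N} {P = P} P? {u} Pu unique = begin
  sum (indicator ∘ P?)                                   ≡⟨ sum-remove {i = u} (indicator ∘ P?) ⟩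
  indicator (P? u) + sum (removeAt (indicator ∘ P?) u)   ≡⟨ cong₂ _+_ (at-u (P? u)) (sum-cong-≗ elsewhere) ⟩
  1 + sum {N} (λ _ → 0)                                  ≡⟨ cong suc (trans (sum-const N 0) (*-zeroʳ N)) ⟩
  1                                                      ∎
  where
  open ≡-Reasoning
  at-u : (d : Dec (P u)) → indicator d ≡ 1
  at-u (yes _)  = refl
  at-u (no ¬Pu) = contradiction Pu ¬Pu
  elsewhere : ∀ j → indicator (P? (punchIn u j)) ≡ 0
  elsewhere j with P? (punchIn u j)
  ... | yes Pj = contradiction (unique _ Pj) (punchInᵢ≢i u j)
  ... | no  _  = refl

adjacent-equal⇒constant : ∀ {a} {A : Set a} {k} (s : Fin (suc k) → A) →
                          (∀ t → s (inject₁ t) ≡ s (fsuc t)) → ∀ i → s i ≡ s fzero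
adjacent-equal⇒constant             s adj fzero    = refl
adjacent-equal⇒constant {k = suc k} s adj (fsuc i) =
  trans (adjacent-equal⇒constant (s ∘ fsuc) (adj ∘ fsuc) i) (sym (adj fzero))

module Construction (p m : ℕ) where

  P Q n : ℕ
  P = suc p
  Q = P + m + m
  n = P * Q

  V : Set
  V = Fin P × Fin Q

  row col : V → ℕ
  row = toℕ ∘ proj₁
  col = toℕ ∘ proj₂

  wrap : Fin P → ℕ
  wrap r = suc (toℕ r) / P

  next prev : V → V
  next (r , c) = r , suc (toℕ c) mod Q
  prev (r , c) = r , (pred Q + toℕ c) mod Q

  shift : ℕ → V → V
  shift δ (r , c) = suc (toℕ r) mod P , (δ + wrap r * m + toℕ c) mod Q

  next∘prev : ∀ x → next (prev x) ≡ x
  next∘prev (r , c) = cong (r ,_) (begin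
    suc (toℕ ((pred Q + toℕ c) mod Q)) mod Q  ≡⟨ [m+toℕ[o-mod-n]]-mod-n≡[m+o]-mod-n 1 (pred Q + toℕ c) Q ⟩
    (suc (pred Q) + toℕ c) mod Q              ≡⟨ cong (λ t → (t + toℕ c) mod Q) (suc-pred Q) ⟩
    (Q + toℕ c) mod Q                         ≡⟨ [n+toℕ[i]]-mod-n≡i c ⟩
    c                                         ∎)
    where open ≡-Reasoning

  prev∘next : ∀ x → prev (next x) ≡ x
  prev∘next (r , c) = cong (r ,_) (begin
    (pred Q + toℕ (suc (toℕ c) mod Q)) mod Q  ≡⟨ [m+toℕ[o-mod-n]]-mod-n≡[m+o]-mod-n (pred Q) (suc (toℕ c)) Q ⟩
    (pred Q + suc (toℕ c)) mod Q              ≡⟨ cong (_mod Q) (+-suc (pred Q) (toℕ c)) ⟩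
    (suc (pred Q) + toℕ c) mod Q              ≡⟨ cong (λ t → (t + toℕ c) mod Q) (suc-pred Q) ⟩
    (Q + toℕ c) mod Q                         ≡⟨ [n+toℕ[i]]-mod-n≡i c ⟩
    c                                         ∎)
    where open ≡-Reasoning

  enc : V → Fin n
  enc = uncurry combine

  dec : Fin n → V
  dec = remQuot Q

  dec∘enc : ∀ x → dec (enc x) ≡ x
  dec∘enc (r , c) = remQuot-combine r c

  enc-injective : ∀ {x y} → enc x ≡ enc y → x ≡ y
  enc-injective {x} {y} eq = trans (sym (dec∘enc x)) (trans (cong dec eq) (dec∘enc y))

  along : (V → V) → Fin n → Fin n
  along f v = enc (f (dec v))

  along-inverse : ∀ {f g : V → V} → (∀ x → f (g x) ≡ x) → ∀ v → along f (along g v) ≡ v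
  along-inverse {f} {g} f∘g v = trans (cong (enc ∘ f) (dec∘enc (g (dec v))))
                                      (trans (cong enc (f∘g (dec v))) (combine-remQuot Q v))

  along-next-injective : ∀ {e e'} → along next e ≡ along next e' → e ≡ e'
  along-next-injective {e} {e'} eq = trans (sym (along-inverse {prev} {next} prev∘next e))
                                           (trans (cong (along prev) eq) (along-inverse {prev} {next} prev∘next e'))

  arcEnds : Fin n ⊎ Fin n → Fin n × Fin n
  arcEnds (inj₁ v) = v , along (shift 0) v
  arcEnds (inj₂ v) = v , along (shift 1) v

  G : MixedGraph n
  G = record { nE = n ; edge = λ v → v , along next v ; nA = n + n ; arc = arcEnds ∘ splitAt n }

  sum-indicator-≟ : ∀ v → sum {n} (λ e → indicator (e ≟ v)) ≡ 1
  sum-indicator-≟ v = sum-indicator-unique (_≟ v) refl (λ _ → id)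

  degree-2 : ∀ v → degree G v ≡ 2
  degree-2 v = cong₂ _+_ (trans (length-filter-tabulate (_≟ v) id) (sum-indicator-≟ v))
                         (trans (length-filter-tabulate (λ e → along next e ≟ v) id) unique-predecessor)
    where
    unique-predecessor : sum {n} (λ e → indicator (along next e ≟ v)) ≡ 1
    unique-predecessor = sum-indicator-unique (λ e → along next e ≟ v) prev↦v
                           (λ e e↦v → along-next-injective {e} {along prev v} (trans e↦v (sym prev↦v)))
      where
      prev↦v : along next (along prev v) ≡ v
      prev↦v = along-inverse {next} {prev} next∘prev v

  outDegree-2 : ∀ v → outDegree G v ≡ 2
  outDegree-2 v = begin
    outDegree G v                                        ≡⟨ length-filter-tabulate (λ a → source a ≟ v) id ⟩
    sum (λ a → indicator (source a ≟ v))                 ≡⟨ sum-↑ n {n} (λ a → indicator (source a ≟ v)) ⟩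
    sum {n} (λ e → indicator (source (e ↑ˡ n) ≟ v)) + sum {n} (λ e → indicator (source (n ↑ʳ e) ≟ v))
      ≡⟨ cong₂ _+_ (sum-cong-≗ {n} (λ e → cong (λ z → indicator (proj₁ (arcEnds z) ≟ v)) (splitAt-↑ˡ n e n)))
                   (sum-cong-≗ {n} (λ e → cong (λ z → indicator (proj₁ (arcEnds z) ≟ v)) (splitAt-↑ʳ n n e))) ⟩
    sum {n} (λ e → indicator (e ≟ v)) + sum {n} (λ e → indicator (e ≟ v))
      ≡⟨ cong₂ _+_ (sum-indicator-≟ v) (sum-indicator-≟ v) ⟩
    2                                                    ∎
    where
    open ≡-Reasoning
    source : Fin (n + n) → Fin n
    source a = proj₁ (arc G a)

  -- No cycle is shorter than P + m

  data Kind : Set where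
    fwd bwd arc₀ arc₁ : Kind

  isArc isArc₁ isFwd isBwd : Kind → ℕ
  isArc fwd  = 0
  isArc bwd  = 0
  isArc arc₀ = 1
  isArc arc₁ = 1
  isArc₁ arc₁ = 1
  isArc₁ _    = 0
  isFwd fwd = 1
  isFwd _   = 0
  isBwd bwd = 1
  isBwd _   = 0

  isArc+isFwd+isBwd≡1 : ∀ K → isArc K + isFwd K + isBwd K ≡ 1
  isArc+isFwd+isBwd≡1 fwd  = refl
  isArc+isFwd+isBwd≡1 bwd  = refl
  isArc+isFwd+isBwd≡1 arc₀ = refl
  isArc+isFwd+isBwd≡1 arc₁ = refl

  isArc₁≤isArc : ∀ K → isArc₁ K ≤ isArc K
  isArc₁≤isArc fwd  = z≤n
  isArc₁≤isArc bwd  = z≤n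
  isArc₁≤isArc arc₀ = z≤n
  isArc₁≤isArc arc₁ = s≤s z≤n

  _⟶[_]_ : V → Kind → V → Set
  x ⟶[ fwd  ] y = y ≡ next x
  x ⟶[ bwd  ] y = x ≡ next y
  x ⟶[ arc₀ ] y = y ≡ shift 0 x
  x ⟶[ arc₁ ] y = y ≡ shift 1 x

  shift-lifts : ∀ δ x → (wrap (proj₁ x) * P + row (shift δ x) ≡ 1 + row x) ×
                        col (shift δ x) ≡ δ + wrap (proj₁ x) * m + col x modulo Q
  shift-lifts δ (r , c) = m/n*n+toℕ[m-mod-n]≡m (suc (toℕ r)) P ,
                          toℕ[m-mod-n]≡m-modulo-n (δ + wrap r * m + toℕ c) Q

  -- A step read in ℕ: w counts passages from the last row to row 0, each adding m to the column.
  LiftedStep : Kind → V → V → Set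
  LiftedStep K x y = ∃ λ w → (w * P + row y ≡ isArc K + row x) ×
                             isBwd K + col y ≡ isFwd K + isArc₁ K + w * m + col x modulo Q

  lifts : ∀ K {x y} → x ⟶[ K ] y → LiftedStep K x y
  lifts fwd  {x} refl = 0 , refl , toℕ[m-mod-n]≡m-modulo-n (suc (col x)) Q
  lifts bwd  {y = y} refl = 0 , refl , ≡-modulo-sym (toℕ[m-mod-n]≡m-modulo-n (suc (col y)) Q)
  lifts arc₀ {x} refl = wrap (proj₁ x) , shift-lifts 0 x
  lifts arc₁ {x} refl = wrap (proj₁ x) , shift-lifts 1 x

  arcKind : Fin n ⊎ Fin n → Kind
  arcKind (inj₁ _) = arc₀
  arcKind (inj₂ _) = arc₁

  kind : ∀ x {u w} → Step G x u w → Kind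
  kind (inj₁ _) (inj₁ _) = fwd
  kind (inj₁ _) (inj₂ _) = bwd
  kind (inj₂ a) _        = arcKind (splitAt n a)

  step-moves : ∀ x {u w} (s : Step G x u w) → dec u ⟶[ kind x s ] dec w
  step-moves (inj₁ e) (inj₁ refl) = dec∘enc (next (dec e))
  step-moves (inj₁ e) (inj₂ refl) = dec∘enc (next (dec e))
  step-moves (inj₂ a) s with splitAt n a
  step-moves (inj₂ a) refl | inj₁ v = dec∘enc (shift 0 (dec v))
  step-moves (inj₂ a) refl | inj₂ v = dec∘enc (shift 1 (dec v))

  same-direction⊎same-edge : ∀ x y {u v w} (s : Step G x u v) (s' : Step G y v w) →
                             isArc (kind x s) ≡ 0 → isArc (kind y s') ≡ 0 → kind x s ≡ kind y s' ⊎ x ≡ y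
  same-direction⊎same-edge (inj₁ e) (inj₁ e') (inj₁ p) (inj₁ q) _ _ = inj₁ refl
  same-direction⊎same-edge (inj₁ e) (inj₁ e') (inj₂ p) (inj₂ q) _ _ = inj₁ refl
  same-direction⊎same-edge (inj₁ e) (inj₁ e') (inj₁ p) (inj₂ q) _ _ =
    inj₂ (cong inj₁ (along-next-injective (trans (cong proj₂ p) (sym (cong proj₂ q)))))
  same-direction⊎same-edge (inj₁ e) (inj₁ e') (inj₂ p) (inj₁ q) _ _ =
    inj₂ (cong inj₁ (trans (cong proj₁ p) (sym (cong proj₁ q))))
  same-direction⊎same-edge (inj₂ a) y s s' arc≡0 _ with splitAt n a
  ... | inj₁ _ = contradiction arc≡0 λ ()
  ... | inj₂ _ = contradiction arc≡0 λ ()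
  same-direction⊎same-edge (inj₁ e) (inj₂ a) s s' _ arc≡0 with splitAt n a
  ... | inj₁ _ = contradiction arc≡0 λ ()
  ... | inj₂ _ = contradiction arc≡0 λ ()

  module ClosedWalk {k} (C : Cycle G (suc k)) where
    open Cycle C

    κ : Fin (suc k) → Kind
    κ i = kind (use i) (steps i)

    lifted : ∀ i → LiftedStep (κ i) (dec (vtx (inject₁ i))) (dec (vtx (fsuc i)))
    lifted i = lifts (κ i) (step-moves (use i) (steps i))

    wraps : Fin (suc k) → ℕ
    wraps i = proj₁ (lifted i)

    A B F M W : ℕ
    A = sum (isArc ∘ κ)
    B = sum (isArc₁ ∘ κ)
    F = sum (isFwd ∘ κ)
    M = sum (isBwd ∘ κ)
    W = sum wraps

    rows-balance : W * P ≡ A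
    rows-balance = trans (*-distribʳ-sum P wraps)
      (closed-telescope (row ∘ dec ∘ vtx) (λ i → wraps i * P) (isArc ∘ κ) (cong (row ∘ dec) (sym closed))
                        (λ i → proj₁ (proj₂ (lifted i))))

    columns-balance : M ≡ F + B + W * m modulo Q
    columns-balance = subst (λ t → M ≡ t modulo Q) offsets
      (closed-telescope-modulo (col ∘ dec ∘ vtx) (isBwd ∘ κ) (λ i → isFwd (κ i) + isArc₁ (κ i) + wraps i * m)
                               (cong (col ∘ dec) (sym closed)) (λ i → proj₂ (proj₂ (lifted i))))
      where
      offsets : sum (λ i → isFwd (κ i) + isArc₁ (κ i) + wraps i * m) ≡ F + B + W * m
      offsets = trans (∑-distrib-+ (λ i → isFwd (κ i) + isArc₁ (κ i)) (λ i → wraps i * m))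
                      (cong₂ _+_ (∑-distrib-+ (isFwd ∘ κ) (isArc₁ ∘ κ)) (sym (*-distribʳ-sum m wraps)))

    length-split : A + F + M ≡ suc k
    length-split = begin
      A + F + M                                 ≡⟨ cong (_+ M) (∑-distrib-+ (isArc ∘ κ) (isFwd ∘ κ)) ⟨
      sum arc+fwd + M                           ≡⟨ ∑-distrib-+ arc+fwd (isBwd ∘ κ) ⟨
      sum (λ i → arc+fwd i + isBwd (κ i))       ≡⟨ sum-cong-≗ (isArc+isFwd+isBwd≡1 ∘ κ) ⟩
      sum {suc k} (λ _ → 1)                     ≡⟨ sum-const (suc k) 1 ⟩
      suc k * 1                                 ≡⟨ *-identityʳ (suc k) ⟩
      suc k                                     ∎
      where
      open ≡-Reasoning
      arc+fwd : Fin (suc k) → ℕ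
      arc+fwd i = isArc (κ i) + isFwd (κ i)

    B≤A : B ≤ A
    B≤A = sum-mono-≤ (isArc₁≤isArc ∘ κ)

    constant-direction : A ≡ 0 → ∀ i → κ i ≡ κ fzero
    constant-direction A≡0 = adjacent-equal⇒constant κ adjacent
      where
      edges-only : ∀ i → isArc (κ i) ≡ 0
      edges-only = sum≡0⇒≡0 (isArc ∘ κ) A≡0
      adjacent : ∀ t → κ (inject₁ t) ≡ κ (fsuc t)
      adjacent t with same-direction⊎same-edge (use (inject₁ t)) (use (fsuc t)) (steps (inject₁ t)) (steps (fsuc t))
                                               (edges-only (inject₁ t)) (edges-only (fsuc t))
      ... | inj₁ same = same
      ... | inj₂ reused = contradiction (trans (sym (toℕ-inject₁ t)) (cong toℕ (useInj reused))) (1+n≢n ∘ sym)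

    one-way : A ≡ 0 → F ≡ 0 ⊎ M ≡ 0
    one-way A≡0 = by-kind (κ fzero) (sum≡0⇒≡0 (isArc ∘ κ) A≡0 fzero) (count isFwd) (count isBwd)
      where
      count : ∀ f → sum (f ∘ κ) ≡ suc k * f (κ fzero)
      count f = trans (sum-cong-≗ (cong f ∘ constant-direction A≡0)) (sum-const (suc k) _)
      by-kind : ∀ K → isArc K ≡ 0 → F ≡ suc k * isFwd K → M ≡ suc k * isBwd K → F ≡ 0 ⊎ M ≡ 0
      by-kind fwd  _  _  M≡ = inj₂ (trans M≡ (*-zeroʳ (suc k)))
      by-kind bwd  _  F≡ _  = inj₁ (trans F≡ (*-zeroʳ (suc k)))
      by-kind arc₀ () _  _
      by-kind arc₁ () _  _

    length-≥-girth : m ≤ P → P + m ≤ suc k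
    length-≥-girth m≤P = ≮⇒≥ λ short → let A≡0 , M≡F = balance short in
      1+n≢0 (trans (sym length-split) (empty A≡0 M≡F (one-way A≡0)))
      where
      balance : suc k < P + m → A ≡ 0 × M ≡ F
      balance short = short-closed-walk-balance {P} {m} {W} {A} {B} {F} {M} m≤P rows-balance B≤A
                        (subst (_< P + m) (sym length-split) short) columns-balance
      empty : A ≡ 0 → M ≡ F → F ≡ 0 ⊎ M ≡ 0 → A + F + M ≡ 0
      empty A≡0 M≡F (inj₁ F≡0) = cong₂ _+_ (cong₂ _+_ A≡0 F≡0) (trans M≡F F≡0)
      empty A≡0 M≡F (inj₂ M≡0) = cong₂ _+_ (cong₂ _+_ A≡0 (trans (sym M≡F) M≡0)) M≡0

  no-short-cycle : m ≤ P → ∀ k → k < P + m → ¬ Cycle G k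
  no-short-cycle m≤P zero    _     C = contradiction (Cycle.pos C) λ ()
  no-short-cycle m≤P (suc k) short C = <⇒≱ short (ClosedWalk.length-≥-girth C m≤P)

  -- A cycle of length P + m

  g : ℕ
  g = P + m

  m<Q : m < Q
  m<Q = s≤s (≤-trans (m≤n+m m p) (m≤m+n (p + m) m))

  column-bound : ∀ {j} → ¬ j < P → g ∸ suc j < Q
  column-bound j≮P = ≤-<-trans (≤-trans (∸-monoʳ-≤ g (m≤n⇒m≤1+n (≮⇒≥ j≮P))) (≤-reflexive (m+n∸m≡n P m))) m<Q

  shift-within : ∀ {j} → suc j < P → shift 0 (j mod P , fzero) ≡ (suc j mod P , fzero)
  shift-within {j} 1+j<P = cong₂ _,_ (cong (λ t → suc t mod P) r≡j) (cong (λ w → (w * m + 0) mod Q) no-wrap)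
    where
    r≡j : toℕ (j mod P) ≡ j
    r≡j = toℕ-mod-< (<-trans (n<1+n j) 1+j<P)
    no-wrap : wrap (j mod P) ≡ 0
    no-wrap = trans (cong (λ t → suc t / P) r≡j) (m<n⇒m/n≡0 1+j<P)

  shift-wraps : ∀ {j} → suc j ≡ P → shift 0 (j mod P , fzero) ≡ (fzero , m mod Q)
  shift-wraps {j} 1+j≡P = cong₂ _,_ row≡0 (cong (_mod Q) column≡m)
    where
    1+r≡P : suc (toℕ (j mod P)) ≡ P
    1+r≡P = trans (cong suc (toℕ-mod-< (subst (j <_) 1+j≡P (n<1+n j)))) 1+j≡P
    row≡0 : suc (toℕ (j mod P)) mod P ≡ fzero
    row≡0 = toℕ-injective (trans (toℕ-fromℕ< _) (trans (cong (_% P) 1+r≡P) (n%n≡0 P)))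
    column≡m : wrap (j mod P) * m + 0 ≡ m
    column≡m = trans (+-identityʳ _) (trans (cong (_* m) one-wrap) (*-identityˡ m))
      where
      one-wrap : wrap (j mod P) ≡ 1
      one-wrap = trans (cong (_/ P) 1+r≡P) (n/n≡1 P)

  cycleVertex : ℕ → V
  cycleVertex j with j <? P
  ... | yes _ = j mod P , fzero
  ... | no  _ = fzero , (g ∸ j) mod Q

  cycleEdge : ℕ → Fin n ⊎ Fin (n + n)
  cycleEdge j with j <? P
  ... | yes _ = inj₂ (enc (j mod P , fzero) ↑ˡ n)
  ... | no  _ = inj₁ (enc (fzero , (g ∸ suc j) mod Q))

  arc-step : ∀ x y → shift 0 x ≡ y → Step G (inj₂ (enc x ↑ˡ n)) (enc x) (enc y)
  arc-step x y eq = trans (cong arcEnds (splitAt-↑ˡ n (enc x) n))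
                          (cong (λ z → enc x , enc z) (trans (cong (shift 0) (dec∘enc x)) eq))

  backward-step : ∀ x y → next x ≡ y → Step G (inj₁ (enc x)) (enc y) (enc x)
  backward-step x y eq = inj₂ (cong (λ z → enc x , enc z) (trans (cong next (dec∘enc x)) eq))

  cycle-step : ∀ j → j < g → Step G (cycleEdge j) (enc (cycleVertex j)) (enc (cycleVertex (suc j)))
  cycle-step j j<g with j <? P | suc j <? P
  ... | yes j<P | yes 1+j<P = arc-step _ _ (shift-within 1+j<P)
  ... | yes j<P | no 1+j≮P  = arc-step _ _ (trans (shift-wraps 1+j≡P) (cong (λ c → fzero , c mod Q) (sym g∸1+j≡m)))
    where
    1+j≡P : suc j ≡ P
    1+j≡P = ≤-antisym j<P (≮⇒≥ 1+j≮P)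
    g∸1+j≡m : g ∸ suc j ≡ m
    g∸1+j≡m = trans (cong (g ∸_) 1+j≡P) (m+n∸m≡n P m)
  ... | no j≮P  | yes 1+j<P = contradiction (<-trans (n<1+n j) 1+j<P) j≮P
  ... | no j≮P  | no _      = backward-step _ _ (cong (λ c → fzero , c mod Q)
                                (trans (cong suc (toℕ-mod-< (column-bound j≮P))) (sym (+-∸-assoc 1 j<g))))

  cycleEdge-injective : ∀ {i j} → i < g → j < g → cycleEdge i ≡ cycleEdge j → i ≡ j
  cycleEdge-injective {i} {j} i<g j<g eq with i <? P | j <? P
  ... | yes i<P | yes j<P = mod-injective-< i<P j<P (cong proj₁ (enc-injective (↑ˡ-injective n _ _ (inj₂-injective eq))))
  ... | no i≮P  | no j≮P  =
    suc-injective (∸-cancelˡ-≡ i<g j<g (mod-injective-< (column-bound i≮P) (column-bound j≮P) columns≡))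
    where
    columns≡ : (g ∸ suc i) mod Q ≡ (g ∸ suc j) mod Q
    columns≡ = cong proj₂ (enc-injective {fzero , _} {fzero , _} (inj₁-injective eq))

  girth-cycle : Cycle G g
  girth-cycle = record
    { pos    = s≤s z≤n
    ; vtx    = enc ∘ cycleVertex ∘ toℕ
    ; closed = trans (cong enc (sym ends)) (cong (enc ∘ cycleVertex) (sym (toℕ-fromℕ g)))
    ; use    = cycleEdge ∘ toℕ
    ; steps  = λ i → subst (λ t → Step G (cycleEdge (toℕ i)) (enc (cycleVertex t)) (enc (cycleVertex (suc (toℕ i)))))
                           (sym (toℕ-inject₁ i)) (cycle-step (toℕ i) (toℕ<n i))
    ; useInj = toℕ-injective ∘ cycleEdge-injective (toℕ<n _) (toℕ<n _)
    }
    where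
    ends : cycleVertex g ≡ (fzero , fzero)
    ends with g <? P
    ... | yes g<P = contradiction (m≤m+n P m) (<⇒≱ g<P)
    ... | no _    = cong (λ c → fzero , c mod Q) (n∸n≡0 g)

  is-2-2-g-graph : m ≤ P → IsRZGGraph G 2 2 g
  is-2-2-g-graph m≤P = degree-2 , outDegree-2 , girth-cycle , no-short-cycle m≤P

f[2,2,P+m]≤P[P+2m] : ∀ P m → 1 ≤ P → m ≤ P → fBoundedBy 2 2 (P + m) (P * (P + m + m))
f[2,2,P+m]≤P[P+2m] (suc p) m _ m≤P = _ , ≤-refl , _ , Construction.is-2-2-g-graph p m m≤P

-- Halves

⌈n/2⌉≡⌊n/2⌋+n%2 : ∀ n → ⌈ n /2⌉ ≡ ⌊ n /2⌋ + n % 2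
⌈n/2⌉≡⌊n/2⌋+n%2 zero          = refl
⌈n/2⌉≡⌊n/2⌋+n%2 (suc zero)    = refl
⌈n/2⌉≡⌊n/2⌋+n%2 (suc (suc n)) = cong suc (⌈n/2⌉≡⌊n/2⌋+n%2 n)

⌊3n/2⌋≡⌈n/2⌉+⌊n/2⌋+⌊n/2⌋ : ∀ n → ⌊ 3 * n /2⌋ ≡ ⌈ n /2⌉ + ⌊ n /2⌋ + ⌊ n /2⌋
⌊3n/2⌋≡⌈n/2⌉+⌊n/2⌋+⌊n/2⌋ zero          = refl
⌊3n/2⌋≡⌈n/2⌉+⌊n/2⌋+⌊n/2⌋ (suc zero)    = refl
⌊3n/2⌋≡⌈n/2⌉+⌊n/2⌋+⌊n/2⌋ (suc (suc n)) = trans (cong ⌊_/2⌋ (3*[2+n]≡6+3*n n))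
  (trans (cong (3 +_) (⌊3n/2⌋≡⌈n/2⌉+⌊n/2⌋+⌊n/2⌋ n)) (3+[a+b+b]≡[1+a]+[1+b]+[1+b] ⌈ n /2⌉ ⌊ n /2⌋))
  where
  3*[2+n]≡6+3*n : ∀ n → 3 * (2 + n) ≡ 6 + 3 * n
  3*[2+n]≡6+3*n = solve-∀
  3+[a+b+b]≡[1+a]+[1+b]+[1+b] : ∀ a b → 3 + (a + b + b) ≡ (1 + a) + (1 + b) + (1 + b)
  3+[a+b+b]≡[1+a]+[1+b]+[1+b] = solve-∀

4[⌈n/2⌉*⌊3n/2⌋]≡3nn : ∀ n → n % 2 ≡ 0 → 4 * (⌈ n /2⌉ * ⌊ 3 * n /2⌋) ≡ 3 * n * n
4[⌈n/2⌉*⌊3n/2⌋]≡3nn n n%2≡0 = begin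
  4 * (c * ⌊ 3 * n /2⌋)  ≡⟨ cong (λ t → 4 * (c * t)) (⌊3n/2⌋≡⌈n/2⌉+⌊n/2⌋+⌊n/2⌋ n) ⟩
  4 * (c * (c + h + h))  ≡⟨ cong (λ c → 4 * (c * (c + h + h))) c≡h ⟩
  4 * (h * (h + h + h))  ≡⟨ identity h ⟩
  3 * (h + h) * (h + h)  ≡⟨ cong (λ t → 3 * t * t) (trans (cong (h +_) (sym c≡h)) (⌊n/2⌋+⌈n/2⌉≡n n)) ⟩
  3 * n * n              ∎
  where
  open ≡-Reasoning
  c h : ℕ
  c = ⌈ n /2⌉
  h = ⌊ n /2⌋
  c≡h : c ≡ h
  c≡h = trans (⌈n/2⌉≡⌊n/2⌋+n%2 n) (trans (cong (h +_) n%2≡0) (+-identityʳ h))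
  identity : ∀ h → 4 * (h * (h + h + h)) ≡ 3 * (h + h) * (h + h)
  identity = solve-∀

4[⌈n/2⌉*⌊3n/2⌋]≡3nn+2n∸1 : ∀ n → n % 2 ≡ 1 → 4 * (⌈ n /2⌉ * ⌊ 3 * n /2⌋) ≡ 3 * n * n + 2 * n ∸ 1
4[⌈n/2⌉*⌊3n/2⌋]≡3nn+2n∸1 n n%2≡1 = sym (trans (cong (_∸ 1) expanded) (m+n∸n≡m _ 1))
  where
  open ≡-Reasoning
  c h : ℕ
  c = ⌈ n /2⌉
  h = ⌊ n /2⌋
  c≡1+h : c ≡ 1 + h
  c≡1+h = trans (⌈n/2⌉≡⌊n/2⌋+n%2 n) (trans (cong (h +_) n%2≡1) (+-comm h 1))
  h+[1+h]≡n : h + (1 + h) ≡ n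
  h+[1+h]≡n = trans (cong (h +_) (sym c≡1+h)) (⌊n/2⌋+⌈n/2⌉≡n n)
  identity : ∀ h → 3 * (h + (1 + h)) * (h + (1 + h)) + 2 * (h + (1 + h)) ≡ 4 * ((1 + h) * ((1 + h) + h + h)) + 1
  identity = solve-∀
  expanded : 3 * n * n + 2 * n ≡ 4 * (c * ⌊ 3 * n /2⌋) + 1
  expanded = begin
    3 * n * n + 2 * n                                      ≡⟨ cong (λ t → 3 * t * t + 2 * t) h+[1+h]≡n ⟨
    3 * (h + (1 + h)) * (h + (1 + h)) + 2 * (h + (1 + h))  ≡⟨ identity h ⟩
    4 * ((1 + h) * ((1 + h) + h + h)) + 1                  ≡⟨ cong (λ c → 4 * (c * (c + h + h)) + 1) c≡1+h ⟨
    4 * (c * (c + h + h)) + 1                              ≡⟨ cong (λ t → 4 * (c * t) + 1) (⌊3n/2⌋≡⌈n/2⌉+⌊n/2⌋+⌊n/2⌋ n) ⟨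
    4 * (c * ⌊ 3 * n /2⌋) + 1                              ∎

mainTheorem5 : (g : ℕ) → 5 ≤ g →
    fBoundedBy 2 2 g (⌈ g /2⌉ * ⌊ 3 * g /2⌋)
    × (g % 2 ≡ 0 → 4 * (⌈ g /2⌉ * ⌊ 3 * g /2⌋) ≡ 3 * g * g)
    × (g % 2 ≡ 1 → 4 * (⌈ g /2⌉ * ⌊ 3 * g /2⌋) ≡ 3 * g * g + 2 * g ∸ 1)
mainTheorem5 g 5≤g = bound , 4[⌈n/2⌉*⌊3n/2⌋]≡3nn g , 4[⌈n/2⌉*⌊3n/2⌋]≡3nn+2n∸1 g
  where
  1≤⌈g/2⌉ : 1 ≤ ⌈ g /2⌉
  1≤⌈g/2⌉ = ⌈n/2⌉-mono (≤-trans (s≤s z≤n) 5≤g)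
  bound : fBoundedBy 2 2 g (⌈ g /2⌉ * ⌊ 3 * g /2⌋)
  bound = subst₂ (fBoundedBy 2 2)
            (trans (+-comm ⌈ g /2⌉ ⌊ g /2⌋) (⌊n/2⌋+⌈n/2⌉≡n g))
            (cong (⌈ g /2⌉ *_) (sym (⌊3n/2⌋≡⌈n/2⌉+⌊n/2⌋+⌊n/2⌋ g)))
            (f[2,2,P+m]≤P[P+2m] ⌈ g /2⌉ ⌊ g /2⌋ 1≤⌈g/2⌉ (⌊n/2⌋≤⌈n/2⌉ g))
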